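{- Let $\ell\ge2$ and $b_0=2^{2^{\ell-1}}-1$. Then the set $\operatorname{PB}(\ell)$ contains an arithmetic progression, and its lower density satisfies $\underline{d}(\operatorname{PB}(\ell))\ge 2/(b_0^2+1)$.
   Context: For an integer $b\ge2$, define $S_{x^2,b}(n)=x_0^2+\dots+x_d^2$ where $n=x_0+x_1b+\dots+x_db^d$ is the base-$b$ expansion of $n\ge0$. A cycle of length $\ell$ of $S_{x^2,b}$ is a sequence of pairwise distinct positive integers $\mathrm{cyc}(n_1,\dots,n_\ell)$ with $S_{x^2,b}(n_i)=n_{i+1}$ ($1\le i<\ell$) and $S_{x^2,b}(n_\ell)=n_1$. It is propagating if every $n_i$ has at most two base-$b$ digits and $b$ divides no $n_i$. $\operatorname{PB}(\ell)$ is the set of integers $b\ge2$ such that $S_{x^2,b}$ has a propagating $\ell$-cycle. For $S\subseteq\mathbb{N}$, the lower density is $\underline{d}(S)=\liminf_{n\to\infty}|S\cap\{1,\dots,n\}|/n$. -}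

module Defs where

open import Data.Nat using (ℕ; zero; suc; _+_; _*_; _∸_; _^_; _≤_; _<_; NonZero)
open import Data.Nat.DivMod using (_/_; _%_)
open import Data.Nat.Divisibility using (_∣_)
open import Data.Product using (Σ; _×_)
open import Data.List using (List; length)
open import Data.List.Relation.Unary.All using (All)
open import Data.List.Relation.Unary.Unique.Propositional using (Unique)
open import Relation.Binary.PropositionalEquality using (_≡_)
open import Relation.Nullary using (¬_)

sqDigitsFuel : (b : ℕ) → .{{_ : NonZero b}} → ℕ → ℕ → ℕ
sqDigitsFuel b zero    n = 0
sqDigitsFuel b (suc f) n = (n % b) * (n % b) + sqDigitsFuel b f (n / b)

-- S_{x^2,b}(n) = x_0^2 + ... + x_d^2  (n has at most n digits, so fuel n suffices; S(0)=0)
S : (b : ℕ) → .{{_ : NonZero b}} → ℕ → ℕ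
S b n = sqDigitsFuel b n n

-- A propagating ℓ-cycle of S_{x^2,b}: n_1,…,n_ℓ indexed as n 0,…,n (ℓ-1).
record PropCycle (b ℓ : ℕ) .{{_ : NonZero b}} : Set where
  field
    n         : ℕ → ℕ
    positive  : ∀ i → i < ℓ → 0 < n i
    distinct  : ∀ i j → i < ℓ → j < ℓ → n i ≡ n j → i ≡ j
    step      : ∀ i → suc i < ℓ → S b (n i) ≡ n (suc i)
    close     : S b (n (ℓ ∸ 1)) ≡ n 0
    twoDigits : ∀ i → i < ℓ → n i < b * b
    notDiv    : ∀ i → i < ℓ → ¬ (b ∣ n i)

PB : ℕ → ℕ → Set
PB ℓ b = Σ ℕ λ c → (b ≡ 2 + c) × PropCycle (2 + c) ℓ

ContainsAP : (ℕ → Set) → Set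
ContainsAP P = Σ ℕ λ a → Σ ℕ λ d → (1 ≤ d) × (∀ t → P (a + t * d))

-- "P has at least m elements in {1,…,n}": a duplicate-free list of such elements of length m.
AtLeastIn : (ℕ → Set) → ℕ → ℕ → Set
AtLeastIn P n m = Σ (List ℕ) λ xs →
  Unique xs × All (λ x → (1 ≤ x) × (x ≤ n) × P x) xs × (length xs ≡ m)

-- Lower density of P is ≥ p/q (q ≥ 1): for every k ≥ 1, eventually
-- |P ∩ {1..n}|/n ≥ p/q - 1/k, written cross-multiplied as  count*q*k + n*q ≥ p*k*n.
LowerDensityGE : (ℕ → Set) → ℕ → ℕ → Set
LowerDensityGE P p q = ∀ k → 1 ≤ k → Σ ℕ λ N → ∀ n → N ≤ n →
  Σ ℕ λ m → AtLeastIn P n m × (p * k * n ≤ m * q * k + n * q)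

-- For b₀ = 2w + 3 and h = (b₀² + 1)/2 = 2w² + 6w + 5, every base b = b₀ + t h carries the number
-- Q = (2 + t b₀) + t b, whose two base-b digits satisfy (2 + t b₀)² + t² = 2Q. Scaling by c keeps the
-- digits (c(2 + t b₀), c t) as long as 2c ≤ w + 2, so S(cQ) = 2c²Q. Starting from c₀ = 1 and iterating
-- c ↦ 2c² gives cᵢ = 2^(2^i - 1); when c_{ℓ-1} = (b₀ + 1)/2 = w + 2, i.e. b₀ = 2^(2^(ℓ-1)) - 1, the number
-- c_{ℓ-1} Q has digits (1 + t(w+1), 1 + t(w+2)) whose squares sum back to Q, closing a propagating ℓ-cycle.
-- Hence PB(ℓ) contains the progression b₀ + t h, of density 1/h = 2/(b₀² + 1).
module Submission where

open import Defs
open import Data.Nat using (ℕ; zero; suc; _+_; _*_; _∸_; _^_; _≤_; _<_; z≤n; s≤s; NonZero)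
open import Data.Nat.Properties
open import Data.Nat.DivMod
open import Data.Nat.Divisibility using (_∣_; n∣m⇒m%n≡0; n∣m*n)
open import Data.Nat.Tactic.RingSolver using (solve-∀)
open import Data.Product using (_×_; _,_)
open import Data.Sum using (inj₁; inj₂)
open import Data.List using (applyUpTo)
open import Data.List.Properties using (length-applyUpTo)
import Data.List.Relation.Unary.All.Properties as All
import Data.List.Relation.Unary.Unique.Propositional.Properties as Unique
open import Relation.Binary.PropositionalEquality
open import Relation.Binary.Definitions using (tri<; tri≈; tri>)
open import Relation.Nullary using (¬_; contradiction)

[x+y*b]%b≡x : ∀ {b} .{{_ : NonZero b}} x y → x < b → (x + y * b) % b ≡ x
[x+y*b]%b≡x {b} x y x<b = trans ([m+kn]%n≡m%n x y b) (m<n⇒m%n≡m x<b)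

[x+y*b]/b≡y : ∀ {b} .{{_ : NonZero b}} x y → x < b → (x + y * b) / b ≡ y
[x+y*b]/b≡y {b} x y x<b = begin
  (x + y * b) / b   ≡⟨ +-distrib-/-∣ʳ x (n∣m*n y) ⟩
  x / b + y * b / b ≡⟨ cong₂ _+_ (m<n⇒m/n≡0 x<b) (m*n/n≡m y b) ⟩
  y                 ∎
  where open ≡-Reasoning

sqDigitsFuel-zero : ∀ b .{{_ : NonZero b}} f → sqDigitsFuel b f 0 ≡ 0
sqDigitsFuel-zero (suc b) zero    = refl
sqDigitsFuel-zero (suc b) (suc f) = sqDigitsFuel-zero (suc b) f

sqDigitsFuel-digit : ∀ b .{{_ : NonZero b}} f y → y < b → y ≤ f → sqDigitsFuel b f y ≡ y * y
sqDigitsFuel-digit b f       zero    _   _ = sqDigitsFuel-zero b f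
sqDigitsFuel-digit b (suc f) (suc y) y<b _
  rewrite m<n⇒m%n≡m y<b | m<n⇒m/n≡0 y<b | sqDigitsFuel-zero b f = +-identityʳ _

S-twoDigits : ∀ {b} .{{_ : NonZero b}} x y → 1 ≤ x → x < b → y < b → S b (x + y * b) ≡ x * x + y * y
S-twoDigits {b} (suc x) y _ x<b y<b
  rewrite [x+y*b]%b≡x (suc x) y x<b | [x+y*b]/b≡y (suc x) y x<b
  = cong (suc x * suc x +_) (sqDigitsFuel-digit b _ y y<b (≤-trans (m≤m*n y b) (m≤n+m _ x)))

record TwoDigits (b n : ℕ) : Set where
  field
    low high : ℕ
    low-pos  : 1 ≤ low
    low<b    : low < b
    high<b   : high < b
    value    : n ≡ low + high * b

module _ {b n : ℕ} .{{_ : NonZero b}} (d : TwoDigits b n) where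
  open TwoDigits d

  TwoDigits⇒S≡ : S b n ≡ low * low + high * high
  TwoDigits⇒S≡ = trans (cong (S b) value) (S-twoDigits low high low-pos low<b high<b)

  TwoDigits⇒0< : 0 < n
  TwoDigits⇒0< = subst (0 <_) (sym value) (≤-trans low-pos (m≤m+n low _))

  TwoDigits⇒<b*b : n < b * b
  TwoDigits⇒<b*b = subst (_< b * b) (sym value)
    (≤-trans (+-monoˡ-< (high * b) low<b) (*-monoˡ-≤ b high<b))

  TwoDigits⇒∤ : ¬ (b ∣ n)
  TwoDigits⇒∤ b∣n = contradiction (begin
      low                  ≡⟨ sym ([x+y*b]%b≡x low high low<b) ⟩
      (low + high * b) % b ≡⟨ cong (_% b) (sym value) ⟩
      n % b                ≡⟨ n∣m⇒m%n≡0 n b b∣n ⟩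
      0                    ∎)
    (≢-sym (<⇒≢ low-pos))
    where open ≡-Reasoning

strictMono⇒injective : (f : ℕ → ℕ) → (∀ {i j} → i < j → f i < f j) → ∀ i j → f i ≡ f j → i ≡ j
strictMono⇒injective f mono i j eq with <-cmp i j
... | tri< i<j _ _ = contradiction eq (<⇒≢ (mono i<j))
... | tri≈ _ i≡j _ = i≡j
... | tri> _ _ j<i = contradiction (sym eq) (<⇒≢ (mono j<i))

mkPropCycle : ∀ {b ℓ} .{{_ : NonZero b}} (n : ℕ → ℕ) →
              (∀ i → i < ℓ → TwoDigits b (n i)) →
              (∀ {i j} → i < j → n i < n j) →
              (∀ i → suc i < ℓ → S b (n i) ≡ n (suc i)) →
              S b (n (ℓ ∸ 1)) ≡ n 0 →
              PropCycle b ℓ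
mkPropCycle n digits mono step close = record
  { n         = n
  ; positive  = λ i i<ℓ → TwoDigits⇒0< (digits i i<ℓ)
  ; distinct  = λ i j _ _ → strictMono⇒injective n mono i j
  ; step      = step
  ; close     = close
  ; twoDigits = λ i i<ℓ → TwoDigits⇒<b*b (digits i i<ℓ)
  ; notDiv    = λ i i<ℓ → TwoDigits⇒∤ (digits i i<ℓ)
  }

scale : ℕ → ℕ
scale zero    = 1
scale (suc i) = 2 * scale i * scale i

scale-pos : ∀ i → 1 ≤ scale i
scale-pos zero    = ≤-refl
scale-pos (suc i) = *-mono-≤ (*-mono-≤ {1} {2} (s≤s z≤n) (scale-pos i)) (scale-pos i)

2*scale≤scale-suc : ∀ i → 2 * scale i ≤ scale (suc i)
2*scale≤scale-suc i = begin
  2 * scale i           ≡⟨ sym (*-identityʳ _) ⟩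
  2 * scale i * 1       ≤⟨ *-monoʳ-≤ (2 * scale i) (scale-pos i) ⟩
  2 * scale i * scale i ∎
  where open ≤-Reasoning

scale-<-suc : ∀ i → scale i < scale (suc i)
scale-<-suc i = begin-strict
  scale i           <⟨ m<n+m (scale i) (scale-pos i) ⟩
  scale i + scale i ≡⟨ cong (scale i +_) (sym (+-identityʳ _)) ⟩
  2 * scale i       ≤⟨ 2*scale≤scale-suc i ⟩
  scale (suc i)     ∎
  where open ≤-Reasoning

scale-mono-< : ∀ {i j} → i < j → scale i < scale j
scale-mono-< {i} {suc j} (s≤s i≤j) with m≤n⇒m<n∨m≡n i≤j
... | inj₁ i<j  = <-trans (scale-mono-< i<j) (scale-<-suc j)
... | inj₂ refl = scale-<-suc i

2*scale≤scale : ∀ {i j} → i < j → 2 * scale i ≤ scale j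
2*scale≤scale {i} {suc j} (s≤s i≤j) with m≤n⇒m<n∨m≡n i≤j
... | inj₁ i<j  = ≤-trans (*-monoʳ-≤ 2 (<⇒≤ (scale-mono-< i<j))) (2*scale≤scale-suc j)
... | inj₂ refl = 2*scale≤scale-suc i

2≤scale-suc : ∀ i → 2 ≤ scale (suc i)
2≤scale-suc i = ≤-trans (*-monoʳ-≤ 2 (scale-pos i)) (2*scale≤scale-suc i)

2^2^i≡2*scale : ∀ i → 2 ^ (2 ^ i) ≡ 2 * scale i
2^2^i≡2*scale zero    = refl
2^2^i≡2*scale (suc i) = begin
  2 ^ (2 ^ i + (2 ^ i + 0))     ≡⟨ cong (λ e → 2 ^ (2 ^ i + e)) (+-identityʳ _) ⟩
  2 ^ (2 ^ i + 2 ^ i)           ≡⟨ ^-distribˡ-+-* 2 (2 ^ i) (2 ^ i) ⟩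
  2 ^ (2 ^ i) * 2 ^ (2 ^ i)     ≡⟨ cong₂ _*_ (2^2^i≡2*scale i) (2^2^i≡2*scale i) ⟩
  (2 * scale i) * (2 * scale i) ≡⟨ square (scale i) ⟩
  2 * (2 * scale i * scale i)   ∎
  where
  open ≡-Reasoning
  square : ∀ c → (2 * c) * (2 * c) ≡ 2 * (2 * c * c)
  square = solve-∀

-- Taking the threshold N = k lets the 1/k slack absorb the remainder n mod d.
AP⇒LowerDensityGE : ∀ {P : ℕ → Set} a d p q → 1 ≤ a → a ≤ d → p * d ≤ q →
                    (∀ t → P (a + t * d)) → LowerDensityGE P p q
AP⇒LowerDensityGE _ zero _ _ (s≤s _) () _
AP⇒LowerDensityGE {P} a d@(suc _) p q 1≤a a≤d pd≤q inP k _ = k , λ n k≤n →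
  let m = n / d in
  m , (applyUpTo term m , Unique.applyUpTo⁺₁ term m (λ i<j _ → <⇒≢ (term-mono i<j))
                        , All.applyUpTo⁺₁ term m (λ t<m → term-valid n t<m)
                        , length-applyUpTo term m)
    , count-bound n (n % d) m k≤n (<⇒≤ (m%n<n n d)) (m≡m%n+[m/n]*n n d)
  where
  term : ℕ → ℕ
  term t = a + t * d

  term-mono : ∀ {s t} → s < t → term s < term t
  term-mono s<t = +-monoʳ-< a (*-monoˡ-< d s<t)

  term-valid : ∀ n {t} → t < n / d → (1 ≤ term t) × (term t ≤ n) × P (term t)
  term-valid n {t} t<m = ≤-trans 1≤a (m≤m+n a _)
                       , ≤-trans (+-monoˡ-≤ (t * d) a≤d) (≤-trans (*-monoˡ-≤ d t<m) (m/n*n≤m n d))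
                       , inP t

  count-bound : ∀ n r m {k} → k ≤ n → r ≤ d → n ≡ r + m * d → p * k * n ≤ m * q * k + n * q
  count-bound n r m {k} k≤n r≤d refl = begin
    p * k * (r + m * d)           ≡⟨ expand p k r m d ⟩
    m * (p * d) * k + k * (p * r) ≤⟨ +-mono-≤ (*-monoˡ-≤ k (*-monoʳ-≤ m pd≤q))
                                             (*-mono-≤ k≤n (≤-trans (*-monoʳ-≤ p r≤d) pd≤q)) ⟩
    m * q * k + (r + m * d) * q   ∎
    where
    open ≤-Reasoning
    expand : ∀ p k r m d → p * k * (r + m * d) ≡ m * (p * d) * k + k * (p * r)
    expand = solve-∀

b₀ : ℕ → ℕ
b₀ w = 3 + 2 * w

-- (b₀² + 1) / 2
h : ℕ → ℕ
h w = 5 + 6 * w + 2 * (w * w)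

base : ℕ → ℕ → ℕ
base w t = b₀ w + t * h w

Q : ℕ → ℕ → ℕ
Q w t = (2 + t * b₀ w) + t * base w t

b₀²+1≡2h : ∀ w → b₀ w * b₀ w + 1 ≡ 2 * h w
b₀²+1≡2h w = lemma w
  where
  lemma : ∀ w → (3 + 2 * w) * (3 + 2 * w) + 1 ≡ 2 * (5 + 6 * w + 2 * (w * w))
  lemma = solve-∀

b₀≤h : ∀ w → b₀ w ≤ h w
b₀≤h w = ≤-trans (m≤m+n _ (2 + 4 * w + 2 * (w * w))) (≤-reflexive (lemma w))
  where
  lemma : ∀ w → (3 + 2 * w) + (2 + 4 * w + 2 * (w * w)) ≡ 5 + 6 * w + 2 * (w * w)
  lemma = solve-∀

2+w≤h : ∀ w → 2 + w ≤ h w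
2+w≤h w = ≤-trans (m≤m+n _ (3 + 5 * w + 2 * (w * w))) (≤-reflexive (lemma w))
  where
  lemma : ∀ w → (2 + w) + (3 + 5 * w + 2 * (w * w)) ≡ 5 + 6 * w + 2 * (w * w)
  lemma = solve-∀

digitSquares≡2Q : ∀ b₀ h t → b₀ * b₀ + 1 ≡ 2 * h →
                  (2 + t * b₀) * (2 + t * b₀) + t * t ≡ 2 * ((2 + t * b₀) + t * (b₀ + t * h))
digitSquares≡2Q b₀ h t b₀²+1≡2h = begin
  (2 + t * b₀) * (2 + t * b₀) + t * t      ≡⟨ expand b₀ t ⟩
  4 + 4 * (t * b₀) + t * t * (b₀ * b₀ + 1) ≡⟨ cong (λ e → 4 + 4 * (t * b₀) + t * t * e) b₀²+1≡2h ⟩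
  4 + 4 * (t * b₀) + t * t * (2 * h)       ≡⟨ collect b₀ h t ⟩
  2 * ((2 + t * b₀) + t * (b₀ + t * h))    ∎
  where
  open ≡-Reasoning
  expand : ∀ b₀ t → (2 + t * b₀) * (2 + t * b₀) + t * t ≡ 4 + 4 * (t * b₀) + t * t * (b₀ * b₀ + 1)
  expand = solve-∀
  collect : ∀ b₀ h t → 4 + 4 * (t * b₀) + t * t * (2 * h) ≡ 2 * ((2 + t * b₀) + t * (b₀ + t * h))
  collect = solve-∀

module _ (w t c : ℕ) (1≤c : 1 ≤ c) (2c≤2+w : 2 * c ≤ 2 + w) where

  c*b₀≤h : c * b₀ w ≤ h w
  c*b₀≤h = *-cancelˡ-≤ 2 (begin
    2 * (c * b₀ w) ≡⟨ sym (*-assoc 2 c (b₀ w)) ⟩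
    2 * c * b₀ w   ≤⟨ *-monoˡ-≤ (b₀ w) 2c≤2+w ⟩
    (2 + w) * b₀ w ≤⟨ ≤-trans (m≤m+n _ (4 + 5 * w + 2 * (w * w))) (≤-reflexive (lemma w)) ⟩
    2 * h w        ∎)
    where
    open ≤-Reasoning
    lemma : ∀ w → (2 + w) * (3 + 2 * w) + (4 + 5 * w + 2 * (w * w)) ≡ 2 * (5 + 6 * w + 2 * (w * w))
    lemma = solve-∀

  scaled-digits : TwoDigits (base w t) (c * Q w t)
  scaled-digits = record
    { low     = c * (2 + t * b₀ w)
    ; high    = c * t
    ; low-pos = *-mono-≤ 1≤c (s≤s (z≤n {1 + t * b₀ w}))
    ; low<b   = subst (_< base w t) (sym (low≡ c t (b₀ w)))
                  (+-mono-<-≤ 2c<b₀ (*-monoʳ-≤ t c*b₀≤h))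
    ; high<b  = <-≤-trans (m<n+m (c * t) {b₀ w} (s≤s z≤n))
                  (+-monoʳ-≤ (b₀ w) (subst (_≤ t * h w) (*-comm t c) (*-monoʳ-≤ t c≤h)))
    ; value   = value≡ c (2 + t * b₀ w) t (base w t)
    }
    where
    2c<b₀ : 2 * c < b₀ w
    2c<b₀ = s≤s (≤-trans 2c≤2+w (+-monoʳ-≤ 2 (m≤m+n w (w + 0))))
    c≤h : c ≤ h w
    c≤h = ≤-trans (m≤m*n c (b₀ w)) c*b₀≤h
    low≡ : ∀ c t b₀ → c * (2 + t * b₀) ≡ 2 * c + t * (c * b₀)
    low≡ = solve-∀
    value≡ : ∀ c x t b → c * (x + t * b) ≡ c * x + c * t * b
    value≡ = solve-∀

  S-scaled : S (base w t) (c * Q w t) ≡ 2 * c * c * Q w t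
  S-scaled = begin
    S (base w t) (c * Q w t)          ≡⟨ TwoDigits⇒S≡ scaled-digits ⟩
    c * x * (c * x) + c * t * (c * t) ≡⟨ factor c x t ⟩
    c * c * (x * x + t * t)           ≡⟨ cong (c * c *_) (digitSquares≡2Q (b₀ w) (h w) t (b₀²+1≡2h w)) ⟩
    c * c * (2 * Q w t)               ≡⟨ regroup c (Q w t) ⟩
    2 * c * c * Q w t                 ∎
    where
    open ≡-Reasoning
    x : ℕ
    x = 2 + t * b₀ w
    factor : ∀ c x t → c * x * (c * x) + c * t * (c * t) ≡ c * c * (x * x + t * t)
    factor = solve-∀
    regroup : ∀ c q → c * c * (2 * q) ≡ 2 * c * c * q
    regroup = solve-∀

-- (2 + w) Q carries once from the low digit into the high one.
top-digits : ∀ w t → TwoDigits (base w t) ((2 + w) * Q w t)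
top-digits w t = record
  { low     = 1 + t * (1 + w)
  ; high    = 1 + t * (2 + w)
  ; low-pos = s≤s z≤n
  ; low<b   = +-mono-<-≤ (s≤s (s≤s z≤n)) (*-monoʳ-≤ t (≤-trans (n≤1+n _) (2+w≤h w)))
  ; high<b  = +-mono-<-≤ (s≤s (s≤s z≤n)) (*-monoʳ-≤ t (2+w≤h w))
  ; value   = value≡ w t
  }
  where
  value≡ : ∀ w t → (2 + w) * ((2 + t * (3 + 2 * w)) + t * ((3 + 2 * w) + t * (5 + 6 * w + 2 * (w * w))))
                 ≡ (1 + t * (1 + w)) + (1 + t * (2 + w)) * ((3 + 2 * w) + t * (5 + 6 * w + 2 * (w * w)))
  value≡ = solve-∀

S-top : ∀ w t → S (base w t) ((2 + w) * Q w t) ≡ Q w t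
S-top w t = trans (TwoDigits⇒S≡ (top-digits w t)) (squares≡ w t)
  where
  squares≡ : ∀ w t → (1 + t * (1 + w)) * (1 + t * (1 + w)) + (1 + t * (2 + w)) * (1 + t * (2 + w))
                   ≡ (2 + t * (3 + 2 * w)) + t * ((3 + 2 * w) + t * (5 + 6 * w + 2 * (w * w)))
  squares≡ = solve-∀

PropCycle-base : ∀ j w t → scale (suc j) ≡ 2 + w → PropCycle (base w t) (2 + j)
PropCycle-base j w t top = mkPropCycle n digits mono step close
  where
  n : ℕ → ℕ
  n i = scale i * Q w t

  below-top : ∀ {i} → i < suc j → 2 * scale i ≤ 2 + w
  below-top {i} i<sj = subst (2 * scale i ≤_) top (2*scale≤scale i<sj)

  digits : ∀ i → i < 2 + j → TwoDigits (base w t) (n i)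
  digits i (s≤s i≤sj) with m≤n⇒m<n∨m≡n i≤sj
  ... | inj₁ i<sj = scaled-digits w t (scale i) (scale-pos i) (below-top i<sj)
  ... | inj₂ refl = subst (λ c → TwoDigits (base w t) (c * Q w t)) (sym top) (top-digits w t)

  mono : ∀ {i i'} → i < i' → n i < n i'
  mono i<i' = *-monoˡ-< (Q w t) (scale-mono-< i<i')

  step : ∀ i → suc i < 2 + j → S (base w t) (n i) ≡ n (suc i)
  step i (s≤s i<sj) = S-scaled w t (scale i) (scale-pos i) (below-top i<sj)

  close : S (base w t) (n (suc j)) ≡ n 0
  close = begin
    S (base w t) (scale (suc j) * Q w t) ≡⟨ cong (λ c → S (base w t) (c * Q w t)) top ⟩
    S (base w t) ((2 + w) * Q w t)       ≡⟨ S-top w t ⟩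
    Q w t                                ≡⟨ sym (*-identityˡ (Q w t)) ⟩
    1 * Q w t                            ∎
    where open ≡-Reasoning

corollary2p8 : (ℓ : ℕ) → 2 ≤ ℓ →
    ContainsAP (PB ℓ) ×
    LowerDensityGE (PB ℓ) 2 ((2 ^ (2 ^ (ℓ ∸ 1)) ∸ 1) * (2 ^ (2 ^ (ℓ ∸ 1)) ∸ 1) + 1)
corollary2p8 (suc zero) (s≤s ())
corollary2p8 (suc (suc j)) _ with m≤n⇒∃[o]m+o≡n (2≤scale-suc j)
... | w , top = (b₀ w , h w , s≤s z≤n , inPB)
              , AP⇒LowerDensityGE (b₀ w) (h w) 2 _ (s≤s z≤n) (b₀≤h w) (≤-reflexive 2h≡q) inPB
  where
  inPB : ∀ t → PB (2 + j) (b₀ w + t * h w)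
  inPB t = (1 + 2 * w + t * h w) , refl , PropCycle-base j w t (sym top)

  2^2^[ℓ-1]∸1≡b₀ : 2 ^ (2 ^ suc j) ∸ 1 ≡ b₀ w
  2^2^[ℓ-1]∸1≡b₀ = cong (_∸ 1) (begin
    2 ^ (2 ^ suc j)   ≡⟨ 2^2^i≡2*scale (suc j) ⟩
    2 * scale (suc j) ≡⟨ cong (2 *_) (sym top) ⟩
    2 * (2 + w)       ≡⟨ double w ⟩
    1 + b₀ w          ∎)
    where
    open ≡-Reasoning
    double : ∀ w → 2 * (2 + w) ≡ 1 + (3 + 2 * w)
    double = solve-∀

  2h≡q : 2 * h w ≡ (2 ^ (2 ^ suc j) ∸ 1) * (2 ^ (2 ^ suc j) ∸ 1) + 1
  2h≡q = trans (sym (b₀²+1≡2h w)) (cong (λ b → b * b + 1) (sym 2^2^[ℓ-1]∸1≡b₀))
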